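{- Let $H$ be a non-trivial Heyting algebra (i.e. $\bot\neq\top$) and let $x\#y$ be a non-trivial apartness term in $H$. Then either $\bot\#y=y$ for all $y\in H$, or $\bot\#y=\neg\neg y$ for all $y\in H$.
   Context: A Heyting algebra is a bounded distributive lattice $\langle H,\wedge,\vee,\rightarrow,\bot,\top\rangle$ in which $a\rightarrow b$ is the largest $c$ with $a\wedge c\le b$; write $\neg a$ for $a\rightarrow\bot$. A term $x\# y$ (a term in the first-order language of Heyting algebras with free variables $x,y$) is an apartness term in $H$ if for all $x,y,z\in H$: $x\#x=\bot$; $x\#y=y\#x$; $x\#y\le (x\#z)\vee(z\#y)$. It is trivial if $x\#y=\bot$ for all $x,y\in H$, and non-trivial otherwise. -}

module Defs where

open import Level using (Level)
open import Data.Product using (_×_)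
open import Relation.Nullary using (¬_)
open import Relation.Binary.Lattice.Bundles using (HeytingAlgebra)

data Term : Set where
  varX varY : Term
  bot top   : Term
  _and_ _or_ _imp_ : Term → Term → Term

module _ {c ℓ₁ ℓ₂ : Level} (H : HeytingAlgebra c ℓ₁ ℓ₂) where
  open HeytingAlgebra H

  neg : Carrier → Carrier
  neg a = a ⇨ ⊥

  eval : Term → Carrier → Carrier → Carrier
  eval varX a b = a
  eval varY a b = b
  eval bot a b = ⊥
  eval top a b = ⊤
  eval (s and t) a b = eval s a b ∧ eval t a b
  eval (s or t) a b = eval s a b ∨ eval t a b
  eval (s imp t) a b = eval s a b ⇨ eval t a b

  IsApartnessTerm : Term → Set (c Level.⊔ ℓ₁ Level.⊔ ℓ₂)
  IsApartnessTerm t =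
    (∀ x → eval t x x ≈ ⊥) ×
    (∀ x y → eval t x y ≈ eval t y x) ×
    (∀ x y z → eval t x y ≤ (eval t x z ∨ eval t z y))

  IsTrivialTerm : Term → Set (c Level.⊔ ℓ₁)
  IsTrivialTerm t = ∀ x y → eval t x y ≈ ⊥

  NonTrivialHA : Set ℓ₁
  NonTrivialHA = ¬ (⊥ ≈ ⊤)

-- A term t is compatible with "agreement below d": if d forces a ↔ a' and b ↔ b',
-- then d forces t(a,b) ↔ t(a',b').  For f y = ⊥ # y this gives ¬ y ∧ f y ≤ f ⊥ = ⊥,
-- so f y ≤ ¬¬ y, and y ∧ f ⊤ ≤ f y.  The closed value f ⊤ = t(⊥,⊤) is ⊥ or ⊤.
-- If it is ⊥, every f y vanishes below y and below ¬ y, hence vanishes because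
-- y ∨ ¬ y is dense, and cotransitivity makes t trivial.  If it is ⊤, the same
-- density argument gives ¬¬ y # y = ⊥, so f y = f (¬¬ y), which lies between
-- ¬¬ y and ¬¬¬¬ y = ¬¬ y.
module Submission where

open import Defs
open import Level using (Level)
open import Data.Product using (_×_; _,_; proj₁; proj₂)
open import Data.Sum using (_⊎_; inj₁; inj₂)
open import Data.Empty using (⊥-elim)
open import Relation.Nullary using (¬_)
open import Relation.Binary.Lattice.Bundles using (HeytingAlgebra)
import Relation.Binary.Lattice.Properties.HeytingAlgebra as HeytingProperties
import Relation.Binary.Lattice.Properties.MeetSemilattice as MeetProperties
import Relation.Binary.Lattice.Properties.JoinSemilattice as JoinProperties

module _ {c ℓ₁ ℓ₂ : Level} (H : HeytingAlgebra c ℓ₁ ℓ₂) where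
  open HeytingAlgebra H
  open HeytingProperties H using (⇨-eval; ⇨-applyʳ; swap-transpose-⇨; ⇨ˡ-contravariant; x≤¬¬x; ∧-distribˡ-∨-≤)
  open MeetProperties meetSemilattice using (∧-monotonic)
  open JoinProperties joinSemilattice using (∨-monotonic)

  Agree : Carrier → Carrier → Carrier → Set ℓ₂
  Agree d a b = (d ∧ a) ≤ b × (d ∧ b) ≤ a

  Agree-sym : ∀ {d a b} → Agree d a b → Agree d b a
  Agree-sym (p , q) = q , p

  Agree-refl : ∀ {d a} → Agree d a a
  Agree-refl = x∧y≤y _ _ , x∧y≤y _ _

  both-hold⇒Agree : ∀ {d a b} → d ≤ a → d ≤ b → Agree d a b
  both-hold⇒Agree p q = trans (x∧y≤x _ _) q , trans (x∧y≤x _ _) p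

  both-fail⇒Agree : ∀ {d a b} → (d ∧ a) ≤ ⊥ → (d ∧ b) ≤ ⊥ → Agree d a b
  both-fail⇒Agree p q = trans p (minimum _) , trans q (minimum _)

  ∧-mono-below : ∀ {d a a' b b'} → (d ∧ a) ≤ a' → (d ∧ b) ≤ b' → (d ∧ (a ∧ b)) ≤ (a' ∧ b')
  ∧-mono-below p q =
    ∧-greatest (trans (∧-monotonic refl (x∧y≤x _ _)) p) (trans (∧-monotonic refl (x∧y≤y _ _)) q)

  ∨-mono-below : ∀ {d a a' b b'} → (d ∧ a) ≤ a' → (d ∧ b) ≤ b' → (d ∧ (a ∨ b)) ≤ (a' ∨ b')
  ∨-mono-below p q = trans (∧-distribˡ-∨-≤ _ _ _) (∨-monotonic p q)

  ⇨-mono-below : ∀ {d a a' b b'} → (d ∧ a') ≤ a → (d ∧ b) ≤ b' → (d ∧ (a ⇨ b)) ≤ (a' ⇨ b')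
  ⇨-mono-below {d} {a} {a'} {b} p q = transpose-⇨ (trans (∧-greatest d-part b-part) q)
    where
    d-part : ((d ∧ (a ⇨ b)) ∧ a') ≤ d
    d-part = trans (x∧y≤x _ _) (x∧y≤x _ _)
    b-part : ((d ∧ (a ⇨ b)) ∧ a') ≤ b
    b-part = trans (∧-greatest (trans (x∧y≤x _ _) (x∧y≤y _ _))
                               (trans (∧-monotonic (x∧y≤x _ _) refl) p))
                   ⇨-eval

  eval-Agree : ∀ s {d a a' b b'} → Agree d a a' → Agree d b b' →
               Agree d (eval H s a b) (eval H s a' b')
  eval-Agree varX p q = p
  eval-Agree varY p q = q
  eval-Agree bot p q = Agree-refl
  eval-Agree top p q = Agree-refl
  eval-Agree (s and u) p q with eval-Agree s p q | eval-Agree u p q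
  ... | s₁ , s₂ | u₁ , u₂ = ∧-mono-below s₁ u₁ , ∧-mono-below s₂ u₂
  eval-Agree (s or u) p q with eval-Agree s p q | eval-Agree u p q
  ... | s₁ , s₂ | u₁ , u₂ = ∨-mono-below s₁ u₁ , ∨-mono-below s₂ u₂
  eval-Agree (s imp u) p q with eval-Agree s p q | eval-Agree u p q
  ... | s₁ , s₂ | u₁ , u₂ = ⇨-mono-below s₂ u₁ , ⇨-mono-below s₁ u₂

  eval-⊥⊤-bivalent : ∀ s → eval H s ⊥ ⊤ ≤ ⊥ ⊎ ⊤ ≤ eval H s ⊥ ⊤
  eval-⊥⊤-bivalent varX = inj₁ refl
  eval-⊥⊤-bivalent varY = inj₂ refl
  eval-⊥⊤-bivalent bot = inj₁ refl
  eval-⊥⊤-bivalent top = inj₂ refl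
  eval-⊥⊤-bivalent (s and u) with eval-⊥⊤-bivalent s | eval-⊥⊤-bivalent u
  ... | inj₁ p | _      = inj₁ (trans (x∧y≤x _ _) p)
  ... | inj₂ _ | inj₁ q = inj₁ (trans (x∧y≤y _ _) q)
  ... | inj₂ p | inj₂ q = inj₂ (∧-greatest p q)
  eval-⊥⊤-bivalent (s or u) with eval-⊥⊤-bivalent s | eval-⊥⊤-bivalent u
  ... | inj₁ p | inj₁ q = inj₁ (∨-least p q)
  ... | inj₂ p | _      = inj₂ (trans p (x≤x∨y _ _))
  ... | inj₁ _ | inj₂ q = inj₂ (trans q (y≤x∨y _ _))
  eval-⊥⊤-bivalent (s imp u) with eval-⊥⊤-bivalent s | eval-⊥⊤-bivalent u
  ... | inj₁ p | _      = inj₂ (transpose-⇨ (trans (x∧y≤y _ _) (trans p (minimum _))))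
  ... | inj₂ _ | inj₂ q = inj₂ (transpose-⇨ (trans (x∧y≤x _ _) q))
  ... | inj₂ p | inj₁ q = inj₁ (trans (∧-greatest refl (trans (maximum _) p)) (trans ⇨-eval q))

  excluded-middle-dense : ∀ {a b} → (a ∧ b) ≤ ⊥ → (neg H a ∧ b) ≤ ⊥ → b ≤ ⊥
  excluded-middle-dense p q = trans (∧-greatest (swap-transpose-⇨ p) refl) q

  ¬¬¬¬≤¬¬ : ∀ a → neg H (neg H (neg H (neg H a))) ≤ neg H (neg H a)
  ¬¬¬¬≤¬¬ a = ⇨ˡ-contravariant (x≤¬¬x (neg H a))

  module Apartness (t : Term) (isApartness : IsApartnessTerm H t) where
    infix 8 _#_
    _#_ : Carrier → Carrier → Carrier
    x # y = eval H t x y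

    #-irrefl : ∀ x → x # x ≈ ⊥
    #-irrefl = proj₁ isApartness

    #-sym : ∀ x y → x # y ≈ y # x
    #-sym = proj₁ (proj₂ isApartness)

    #-cotrans : ∀ x y z → x # y ≤ (x # z ∨ z # y)
    #-cotrans = proj₂ (proj₂ isApartness)

    Agree⇒#≤⊥ : ∀ {d x y} → Agree d x y → (d ∧ x # y) ≤ ⊥
    Agree⇒#≤⊥ p = trans (proj₁ (eval-Agree t Agree-refl (Agree-sym p))) (reflexive (#-irrefl _))

    #≤⊥⇒#-cong : ∀ {x y} z → x # y ≤ ⊥ → z # x ≈ z # y
    #≤⊥⇒#-cong {x} {y} z x#y≤⊥ =
      antisym (one-way (trans (reflexive (#-sym y x)) x#y≤⊥)) (one-way x#y≤⊥)
      where
      one-way : ∀ {u v} → v # u ≤ ⊥ → z # u ≤ z # v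
      one-way v#u≤⊥ = trans (#-cotrans z _ _) (∨-least refl (trans v#u≤⊥ (minimum _)))

    ¬∧⊥#≤⊥ : ∀ y → (neg H y ∧ ⊥ # y) ≤ ⊥
    ¬∧⊥#≤⊥ y = Agree⇒#≤⊥ (both-fail⇒Agree (x∧y≤y _ _) ⇨-eval)

    ∧⊥#≤⊥#⊤ : ∀ y → (y ∧ ⊥ # y) ≤ ⊥ # ⊤
    ∧⊥#≤⊥#⊤ y = proj₁ (eval-Agree t Agree-refl (both-hold⇒Agree refl (maximum _)))

    ∧⊥#⊤≤⊥# : ∀ y → (y ∧ ⊥ # ⊤) ≤ ⊥ # y
    ∧⊥#⊤≤⊥# y = proj₂ (eval-Agree t Agree-refl (both-hold⇒Agree refl (maximum _)))

    ⊥#≤¬¬ : ∀ y → ⊥ # y ≤ neg H (neg H y)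
    ⊥#≤¬¬ y = swap-transpose-⇨ (¬∧⊥#≤⊥ y)

    ⊥#⊤≤⊥⇒trivial : ⊥ # ⊤ ≤ ⊥ → IsTrivialTerm H t
    ⊥#⊤≤⊥⇒trivial ⊥#⊤≤⊥ x y = antisym (trans (#-cotrans x y ⊥) (∨-least x#⊥≤⊥ (⊥#≤⊥ y))) (minimum _)
      where
      ⊥#≤⊥ : ∀ y → ⊥ # y ≤ ⊥
      ⊥#≤⊥ y = excluded-middle-dense (trans (∧⊥#≤⊥#⊤ y) ⊥#⊤≤⊥) (¬∧⊥#≤⊥ y)
      x#⊥≤⊥ : x # ⊥ ≤ ⊥
      x#⊥≤⊥ = trans (reflexive (#-sym x ⊥)) (⊥#≤⊥ x)

    ¬¬#≤⊥ : ∀ y → neg H (neg H y) # y ≤ ⊥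
    ¬¬#≤⊥ y = excluded-middle-dense
      (Agree⇒#≤⊥ (both-hold⇒Agree (x≤¬¬x y) refl))
      (Agree⇒#≤⊥ (both-fail⇒Agree (⇨-applyʳ refl) ⇨-eval))

    ⊤≤⊥#⊤⇒⊥#≈¬¬ : ⊤ ≤ ⊥ # ⊤ → ∀ y → ⊥ # y ≈ neg H (neg H y)
    ⊤≤⊥#⊤⇒⊥#≈¬¬ ⊤≤⊥#⊤ y = Eq.trans (Eq.sym (#≤⊥⇒#-cong ⊥ (¬¬#≤⊥ y))) ⊥#¬¬≈¬¬
      where
      ¬¬y = neg H (neg H y)
      ⊥#¬¬≈¬¬ : ⊥ # ¬¬y ≈ ¬¬y
      ⊥#¬¬≈¬¬ = antisym (trans (⊥#≤¬¬ ¬¬y) (¬¬¬¬≤¬¬ y))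
                        (trans (∧-greatest refl (trans (maximum _) ⊤≤⊥#⊤)) (∧⊥#⊤≤⊥# ¬¬y))

    trivial-or-⊥#≈¬¬ : IsTrivialTerm H t ⊎ (∀ y → ⊥ # y ≈ neg H (neg H y))
    trivial-or-⊥#≈¬¬ with eval-⊥⊤-bivalent t
    ... | inj₁ ⊥#⊤≤⊥ = inj₁ (⊥#⊤≤⊥⇒trivial ⊥#⊤≤⊥)
    ... | inj₂ ⊤≤⊥#⊤ = inj₂ (⊤≤⊥#⊤⇒⊥#≈¬¬ ⊤≤⊥#⊤)

mainTheorem8 : {c ℓ₁ ℓ₂ : Level} (H : HeytingAlgebra c ℓ₁ ℓ₂) (t : Term) →
    NonTrivialHA H → IsApartnessTerm H t → ¬ IsTrivialTerm H t →
    (∀ y → HeytingAlgebra._≈_ H (eval H t (HeytingAlgebra.⊥ H) y) y) ⊎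
    (∀ y → HeytingAlgebra._≈_ H (eval H t (HeytingAlgebra.⊥ H) y) (neg H (neg H y)))
mainTheorem8 H t _ isApartness nonTrivialTerm with Apartness.trivial-or-⊥#≈¬¬ H t isApartness
... | inj₁ trivial = ⊥-elim (nonTrivialTerm trivial)
... | inj₂ ⊥#≈¬¬   = inj₂ ⊥#≈¬¬
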